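{- Let $\varphi=(n,r,i,j,a,b,N)$ be a valid tuple and let $\nu\in\mathcal{D}_\varphi$ be tall. Run Algorithm 1 on input $(\varphi,\nu)$, with any choices. Then in every intermediate element $\xi^{(m)}$, each basis symbol $\overline{s}_\lambda\otimes[\mu^{(1)},\ldots,\mu^{(k)}]$ occurring with nonzero coefficient has an integer coefficient of sign $(-1)^{k+1}$.
   Context: $\Lambda$ is the ring of symmetric functions over $\mathbb{Z}$, with Schur basis $s_\lambda$ and Littlewood–Richardson coefficients $c^{\nu}_{\lambda,\mu}$ defined by $s_\lambda s_\mu=\sum_\nu c^\nu_{\lambda,\mu}s_\nu$. Partitions are identified with Young diagrams. $p^q$ denotes the rectangle with $q$ parts equal to $p$. $\overline{\Lambda}=\Lambda/\mathrm{Span}_\mathbb{Z}\{s_\lambda\mid\lambda\not\subseteq(n-r)^r\}$, and $\overline{s}_\lambda$ is the image of $s_\lambda$. A tuple of integers $\varphi=(n,r,i,j,a,b,N)$ is valid if all entries are $\geq 1$ and $r<n$, $a+j\leq r$, $a+i\leq n-r$, $b\leq i$, $b\leq j$, $N\leq ab$. $\mathcal{D}_\varphi$ is the set of partitions $\nu$ with: \begin{itemize} \item $i^j\subseteq\nu\subseteq (n-r)^r$; \item $|\nu|=ij+N$; \item $\nu_{j+1}\leq b$; \item at most $j+a$ parts. \end{itemize} For such $\nu$, set $\nu_B=(\nu_{j+1},\ldots,\nu_{j+a})$. Such a $\nu$ is tall if $\nu_1=i$; in this case $|\nu_B|=N$. Algorithm 1 works in the free $\mathbb{Z}$-module $F$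 whose basis consists of formal symbols $\overline{s}_\lambda\otimes[\mu^{(1)},\ldots,\mu^{(k)}]$. Here $\lambda\subseteq(n-r)^r$ is a partition (possibly empty), $k\geq 0$, and $[\mu^{(1)},\ldots,\mu^{(k)}]$ is an unordered list (multiset) of nonempty partitions contained in $(n-r)^r$. The list stands for the unexpanded product $\overline{s}_{\mu^{(1)}}\cdots\overline{s}_{\mu^{(k)}}$. On input $(\varphi,\nu)$ with $\nu$ tall, the algorithm runs as follows. \begin{enumerate} \item Initialize \[ \xi^{(0)}=\sum_{\lambda\subsetneq\nu_B}\ \sum_{\substack{\theta\subseteq(n-r)^r\\|\theta|=N-|\lambda|}}c^{\nu_B}_{\lambda,\theta}\ \overline{s}_\lambda\otimes[\theta]. \] \item While the current element $\xi^{(m-1)}$ contains, with nonzero coefficient $\gamma$, some basis symbol $\overline{s}_\lambda\otimes[\mu^{(1)},\ldots,\mu^{(k)}]$ with $|\lambda|>0$, choose one such symbol and set \[ \xi^{(m)}=\xi^{(m-1)}-\gamma\sum_{\rho,\tau\subseteq(n-r)^r}c^\lambda_{\rho,\tau}\ \overline{s}_\rho\otimes[\mu^{(1)},\ldots,\mu^{(k)},\tau], \] where $\tau$ is omitted from the list when $\tau=\emptyset$. \item When no such symbol remains, output the current element. \end{enumerate} -}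

module Defs where

open import Data.Nat using (ℕ; zero; suc; _+_; _*_; _∸_; _≤_; _<_; _≡ᵇ_; _≤ᵇ_; _<ᵇ_)
open import Data.Integer using (ℤ; +_; -_; 0ℤ; 1ℤ) renaming (_*_ to _*ℤ_)
open import Data.Bool using (Bool; true; false; _∧_; _∨_; not; if_then_else_)
open import Data.List using (List; []; _∷_; [_]; _++_; concatMap; filter; length; drop; replicate; map)
open import Data.Nat.ListAction using (sum)
open import Data.Maybe using (Maybe; just; nothing)
open import Data.Product using (_×_; _,_)
open import Data.Unit using (⊤)
open import Data.Empty using (⊥)
open import Relation.Binary.PropositionalEquality using (_≡_)
open import Relation.Binary.Construct.Closure.ReflexiveTransitive using (Star)
open import Relation.Nullary.Decidable using (⌊_⌋)
open import Data.Integer using (_≟_)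

IsPartition : List ℕ → Set
IsPartition []           = ⊤
IsPartition (x ∷ [])     = 0 < x
IsPartition (x ∷ y ∷ xs) = y ≤ x × IsPartition (y ∷ xs)

-- k-th part, 0-indexed (so part ν k = ν_{k+1}); 0 beyond the length.
part : List ℕ → ℕ → ℕ
part []       _       = 0
part (x ∷ xs) zero    = x
part (x ∷ xs) (suc k) = part xs k

_⊆ₚ_ : List ℕ → List ℕ → Set
λ' ⊆ₚ μ = ∀ k → part λ' k ≤ part μ k

rect : ℕ → ℕ → List ℕ
rect p q = replicate q p

eqList : List ℕ → List ℕ → Bool
eqList []       []       = true
eqList (x ∷ xs) (y ∷ ys) = (x ≡ᵇ y) ∧ eqList xs ys
eqList _        _        = false

-- containment, for lists without zero parts
subB : List ℕ → List ℕ → Bool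
subB []       _        = true
subB (x ∷ xs) []       = false
subB (x ∷ xs) (y ∷ ys) = (x ≤ᵇ y) ∧ subB xs ys

removeFirst : List ℕ → List (List ℕ) → Maybe (List (List ℕ))
removeFirst x []       = nothing
removeFirst x (y ∷ ys) with eqList x y
... | true  = just ys
... | false with removeFirst x ys
...   | nothing  = nothing
...   | just zs  = just (y ∷ zs)

bagEq : List (List ℕ) → List (List ℕ) → Bool
bagEq []       []       = true
bagEq []       (_ ∷ _)  = false
bagEq (x ∷ xs) ys with removeFirst x ys
... | nothing  = false
... | just zs  = bagEq xs zs

partsIn : ℕ → ℕ → List (List ℕ)
partsIn zero    p = [] ∷ []
partsIn (suc q) p = [] ∷ concatMap (λ x → map (x ∷_) (partsIn q x)) (range1 p)
  where
  range1 : ℕ → List ℕ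
  range1 zero    = []
  range1 (suc m) = range1 m ++ (suc m ∷ [])

-- Littlewood–Richardson coefficient c^ν_{λ,μ}, by the Littlewood–Richardson
-- rule: the number of semistandard fillings of the skew shape ν/λ with
-- content μ whose reverse reading word (rows right-to-left, top-to-bottom)
-- is a lattice word.

private
  range1' : ℕ → List ℕ
  range1' zero    = []
  range1' (suc m) = range1' m ++ (suc m ∷ [])

  weakInc : ℕ → ℕ → ℕ → List (List ℕ)
  weakInc zero      lo m = [] ∷ []
  weakInc (suc len) lo m =
    concatMap (λ v → if lo ≤ᵇ v then map (v ∷_) (weakInc len v m) else [])
              (range1' m)

  nth : List ℕ → ℕ → ℕ
  nth = part

  -- column strictness: row filling `row` starts at column c,
  -- previous row filling `prev` starts at column pc (pc = ∞ encoded by a flag)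
  colOK : Bool → ℕ → List ℕ → ℕ → List ℕ → Bool
  colOK hasPrev pc prev c []       = true
  colOK hasPrev pc prev c (v ∷ vs) =
    (if hasPrev ∧ (pc ≤ᵇ c) then (nth prev (c ∸ pc) <ᵇ v) else true)
    ∧ colOK hasPrev pc prev (suc c) vs

  incr : ℕ → List ℕ → List ℕ       -- increment entry at 1-indexed position v
  incr v       []       = []
  incr (suc zero) (x ∷ xs) = suc x ∷ xs
  incr (suc (suc v)) (x ∷ xs) = x ∷ incr (suc v) xs
  incr zero    xs       = xs

  lattice : List ℕ → List ℕ → Maybe (List ℕ)
  lattice cnt []       = just cnt
  lattice cnt (v ∷ vs) with incr v cnt
  ... | cnt' with (v ≡ᵇ 1) ∨ (part cnt' (v ∸ 1) ≤ᵇ part cnt' (v ∸ 2))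
  ...   | false = nothing
  ...   | true  = lattice cnt' vs

  rev : List ℕ → List ℕ
  rev []       = []
  rev (x ∷ xs) = rev xs ++ (x ∷ [])

  -- count completions: rows given as (start column, length) list
  count : ℕ → Bool → ℕ → List ℕ → List ℕ → List (ℕ × ℕ) → List ℕ → ℕ
  count m hasPrev pc prev cnt []               μ = if eqList cnt μ then 1 else 0
  count m hasPrev pc prev cnt ((c , len) ∷ rs) μ =
    sum (map step (weakInc len 1 m))
    where
    step : List ℕ → ℕ
    step row with colOK hasPrev pc prev c row
    ... | false = 0
    ... | true with lattice cnt (rev row)
    ...   | nothing   = 0
    ...   | just cnt' = count m true c row cnt' rs μ

  skewRows : List ℕ → List ℕ → List (ℕ × ℕ)
  skewRows []       _   = []
  skewRows (x ∷ ν') lam = (part lam 0 , x ∸ part lam 0) ∷ skewRows ν' (drop 1 lam)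

-- lr ν λ μ = c^ν_{λ,μ}
lr : List ℕ → List ℕ → List ℕ → ℕ
lr ν' lam μ =
  if subB lam ν' ∧ (sum ν' ≡ᵇ sum lam + sum μ)
  then count (length μ) false 0 [] (replicate (length μ) 0) (skewRows ν' lam) μ
  else 0

-- A basis symbol s̄_λ ⊗ [μ¹,…,μᵏ] is a pair
-- (λ , list of μ's); the list is read as a multiset.  An element of F is
-- a finite formal sum, represented as a list of (coefficient , symbol);
-- its coefficient on a symbol is the sum of the coefficients of all
-- entries equal to that symbol (λ equal, lists equal as multisets).

Symbol : Set
Symbol = List ℕ × List (List ℕ)

FElt : Set
FElt = List (ℤ × Symbol)

symEq : Symbol → Symbol → Bool
symEq (l₁ , L₁) (l₂ , L₂) = eqList l₁ l₂ ∧ bagEq L₁ L₂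

coeff : FElt → Symbol → ℤ
coeff []              s = 0ℤ
coeff ((γ , t) ∷ ξ)   s = (if symEq t s then γ else 0ℤ) Data.Integer.+ coeff ξ s

box : ℕ → ℕ → List (List ℕ)
box n r = partsIn r (n ∸ r)

-- ν_B = (ν_{j+1}, …, ν_{j+a}) (ν has at most j+a parts)
nuB : ℕ → List ℕ → List ℕ
nuB j ν' = drop j ν'

-- ξ⁽⁰⁾ = Σ_{λ ⊊ ν_B} Σ_{θ ⊆ (n-r)^r, |θ| = N - |λ|} c^{ν_B}_{λ,θ} s̄_λ ⊗ [θ]
xi0 : ℕ → ℕ → ℕ → ℕ → List ℕ → FElt
xi0 n r j N ν' =
  concatMap (λ lam →
    if subB lam (nuB j ν') ∧ not (eqList lam (nuB j ν'))
    then concatMap (λ θ →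
           if sum θ ≡ᵇ (N ∸ sum lam)
           then (+ lr (nuB j ν') lam θ , (lam , θ ∷ [])) ∷ []
           else [])
         (box n r)
    else [])
  (box n r)

extend : List ℕ → List (List ℕ) → List (List ℕ)
extend []      L = L
extend (t ∷ τ) L = (t ∷ τ) ∷ L

-- γ Σ_{ρ,τ ⊆ (n-r)^r} c^λ_{ρ,τ} s̄_ρ ⊗ [μ…, τ], negated
correction : ℕ → ℕ → ℤ → Symbol → FElt
correction n r γ (lam , L) =
  concatMap (λ ρ → map (λ τ → (- (γ *ℤ + lr lam ρ τ) , (ρ , extend τ L))) (box n r))
            (box n r)

-- One step of Algorithm 1 (with an arbitrary choice of symbol).
data Step (n r : ℕ) : FElt → FElt → Set where
  step : ∀ ξ (lam : List ℕ) (L : List (List ℕ)) →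
         0 < sum lam →
         (coeff ξ (lam , L) ≡ 0ℤ → ⊥) →
         Step n r ξ (ξ ++ correction n r (coeff ξ (lam , L)) (lam , L))

Reachable : ℕ → ℕ → ℕ → ℕ → List ℕ → FElt → Set
Reachable n r j N ν' ξ = Star (Step n r) (xi0 n r j N ν') ξ

record Valid (n r i j a b N : ℕ) : Set where
  field
    n≥1 : 1 ≤ n
    r≥1 : 1 ≤ r
    i≥1 : 1 ≤ i
    j≥1 : 1 ≤ j
    a≥1 : 1 ≤ a
    b≥1 : 1 ≤ b
    N≥1 : 1 ≤ N
    r<n : r < n
    a+j≤r : a + j ≤ r
    a+i≤n-r : a + i ≤ n ∸ r
    b≤i : b ≤ i
    b≤j : b ≤ j
    N≤ab : N ≤ a * b

record InD (n r i j a b N : ℕ) (ν' : List ℕ) : Set where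
  field
    partition : IsPartition ν'
    lower     : rect i j ⊆ₚ ν'
    upper     : ν' ⊆ₚ rect (n ∸ r) r
    size      : sum ν' ≡ i * j + N
    rowBound  : part ν' j ≤ b
    numParts  : length ν' ≤ j + a

Tall : ℕ → List ℕ → Set
Tall i ν' = part ν' 0 ≡ i

negOnePow : ℕ → ℤ
negOnePow zero    = 1ℤ
negOnePow (suc k) = - negOnePow k

-- Write ε(s̄_λ ⊗ [μ¹,…,μᵏ]) = (-1)^(k+1). Every intermediate element ξ satisfies
-- ε(s) · coeff(ξ, s) ≥ 0 for all symbols s; with coeff(ξ, s) ≠ 0 this is the claim.
-- It holds for ξ⁽⁰⁾, whose coefficients are Littlewood–Richardson coefficients on
-- one-element lists. A step on s̄_λ ⊗ L with coefficient γ subtracts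
-- γ Σ c^λ_{ρ,τ} s̄_ρ ⊗ [L, τ]. Since c^λ_{ρ,∅} = [ρ = λ], the terms with τ = ∅ can
-- only cancel the chosen symbol itself, leaving 0 or γ there. Every other term
-- lands on a list one longer, whose expected sign is opposite to that of γ, so
-- subtracting a nonnegative multiple of γ there preserves the sign.
module Submission where

open import Defs
open import Data.Bool using (true; false; _∧_; if_then_else_)
open import Data.Bool.Properties using (∧-conicalˡ; ∧-conicalʳ; T-≡)
open import Data.Empty using (⊥)
open import Data.Integer.Base as ℤ using (ℤ; +_; -_; 0ℤ; 1ℤ; _+_; _*_; _≤_; _<_; +≤+)
import Data.Integer.Properties as ℤ
open import Data.Integer.Solver using (module +-*-Solver)
open import Data.List using (List; []; _∷_; _++_; [_]; map; concatMap; length; applyUpTo)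
open import Data.List.Properties using (applyUpTo-∷ʳ; ∷-injectiveˡ; ∷-injectiveʳ; ≡-dec)
open import Data.List.Membership.Propositional using (_∈_)
open import Data.List.Membership.Propositional.Properties using (∈-map⁻)
open import Data.List.Relation.Binary.Disjoint.Propositional using (Disjoint)
open import Data.List.Relation.Binary.Permutation.Propositional
  using (_↭_; ↭-refl; ↭-prep; ↭-swap; ↭-trans; ↭-sym)
open import Data.List.Relation.Binary.Permutation.Propositional.Properties
  using (↭-length; drop-∷; ∈-resp-↭; ↭-empty-inv)
open import Data.List.Relation.Unary.All as All using (All; []; _∷_)
import Data.List.Relation.Unary.All.Properties as All
open import Data.List.Relation.Unary.AllPairs as AllPairs using ([]; _∷_)
import Data.List.Relation.Unary.AllPairs.Properties as AllPairs
open import Data.List.Relation.Unary.Any using (here; there)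
open import Data.List.Relation.Unary.Unique.Propositional using (Unique)
import Data.List.Relation.Unary.Unique.Propositional.Properties as Unique
open import Data.Maybe using (just)
open import Data.Nat.Base as ℕ using (ℕ; zero; suc; z≤n; s≤s; _≡ᵇ_; _≤ᵇ_; _∸_)
import Data.Nat.Properties as ℕ
open import Data.Nat.ListAction using (sum)
open import Data.Product using (∃; _×_; _,_; proj₁; proj₂)
open import Data.Sum using ([_,_]′)
open import Function using (_∘_; id; case_of_)
open import Function.Bundles using (Equivalence)
open import Relation.Binary.Construct.Closure.ReflexiveTransitive using (Star; fold)
open import Relation.Binary.Definitions using (DecidableEquality)
open import Relation.Binary.PropositionalEquality
  using (_≡_; _≢_; refl; sym; trans; cong; cong₂; subst; module ≡-Reasoning)
open import Relation.Nullary using (¬_; yes; no; contradiction)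

∧≡true : ∀ a b → a ∧ b ≡ true → a ≡ true × b ≡ true
∧≡true a b e = ∧-conicalˡ a b e , ∧-conicalʳ a b e

≡ᵇ-refl : ∀ m → (m ≡ᵇ m) ≡ true
≡ᵇ-refl m = Equivalence.to T-≡ (ℕ.≡⇒≡ᵇ m m refl)

≡ᵇ-sound : ∀ m n → (m ≡ᵇ n) ≡ true → m ≡ n
≡ᵇ-sound m n e = ℕ.≡ᵇ⇒≡ m n (Equivalence.from T-≡ e)

≤ᵇ-refl : ∀ m → (m ≤ᵇ m) ≡ true
≤ᵇ-refl m = Equivalence.to T-≡ (ℕ.≤⇒≤ᵇ (ℕ.≤-refl {m}))

≤ᵇ-sound : ∀ m n → (m ≤ᵇ n) ≡ true → m ℕ.≤ n
≤ᵇ-sound m n e = ℕ.≤ᵇ⇒≤ m n (Equivalence.from T-≡ e)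

eqList-sound : ∀ xs ys → eqList xs ys ≡ true → xs ≡ ys
eqList-sound []       []       _ = refl
eqList-sound (x ∷ xs) (y ∷ ys) e with ∧≡true (x ≡ᵇ y) (eqList xs ys) e
... | x≡y , xs≡ys = cong₂ _∷_ (≡ᵇ-sound x y x≡y) (eqList-sound xs ys xs≡ys)

eqList-refl : ∀ xs → eqList xs xs ≡ true
eqList-refl []       = refl
eqList-refl (x ∷ xs) rewrite ≡ᵇ-refl x = eqList-refl xs

removeFirst-sound : ∀ x ys {zs} → removeFirst x ys ≡ just zs → ys ↭ x ∷ zs
removeFirst-sound x (y ∷ ys) e with eqList x y in x≡y
removeFirst-sound x (y ∷ ys) refl | true rewrite eqList-sound x y x≡y = ↭-refl
removeFirst-sound x (y ∷ ys) e    | false with removeFirst x ys in x∈ys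
removeFirst-sound x (y ∷ ys) refl | false | just zs =
  ↭-trans (↭-prep y (removeFirst-sound x ys x∈ys)) (↭-swap y x ↭-refl)

removeFirst-complete : ∀ x ys → x ∈ ys → ∃ λ zs → removeFirst x ys ≡ just zs
removeFirst-complete x (y ∷ ys) _ with eqList x y in x≡y
removeFirst-complete x (y ∷ ys) _            | true  = ys , refl
removeFirst-complete x (x ∷ ys) (here refl)  | false =
  case trans (sym x≡y) (eqList-refl x) of λ ()
removeFirst-complete x (y ∷ ys) (there x∈ys) | false with removeFirst-complete x ys x∈ys
... | zs , e rewrite e = y ∷ zs , refl

bagEq-sound : ∀ xs ys → bagEq xs ys ≡ true → xs ↭ ys
bagEq-sound []       []  _ = ↭-refl
bagEq-sound (x ∷ xs) ys e with removeFirst x ys in x∈ys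
... | just zs = ↭-trans (↭-prep x (bagEq-sound xs zs e)) (↭-sym (removeFirst-sound x ys x∈ys))

bagEq-complete : ∀ xs ys → xs ↭ ys → bagEq xs ys ≡ true
bagEq-complete []       ys xs↭ys rewrite ↭-empty-inv (↭-sym xs↭ys) = refl
bagEq-complete (x ∷ xs) ys xs↭ys with removeFirst-complete x ys (∈-resp-↭ xs↭ys (here refl))
... | zs , e rewrite e =
  bagEq-complete xs zs (drop-∷ (↭-trans xs↭ys (removeFirst-sound x ys e)))

infix 4 _≈_

_≈_ : Symbol → Symbol → Set
t ≈ s = proj₁ t ≡ proj₁ s × proj₂ t ↭ proj₂ s

≈-sym : ∀ {t s} → t ≈ s → s ≈ t
≈-sym (l≡ , L↭) = sym l≡ , ↭-sym L↭

≈-trans : ∀ {t s u} → t ≈ s → s ≈ u → t ≈ u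
≈-trans (l≡ , L↭) (l≡′ , L↭′) = trans l≡ l≡′ , ↭-trans L↭ L↭′

symEq-sound : ∀ t s → symEq t s ≡ true → t ≈ s
symEq-sound (l , L) (l′ , L′) e with ∧≡true (eqList l l′) (bagEq L L′) e
... | l≡l′ , L≡L′ = eqList-sound l l′ l≡l′ , bagEq-sound L L′ L≡L′

symEq-complete : ∀ t s → t ≈ s → symEq t s ≡ true
symEq-complete (l , L) (.l , L′) (refl , L↭L′) rewrite eqList-refl l = bagEq-complete L L′ L↭L′

symEq-false : ∀ {t s} → symEq t s ≡ false → ¬ t ≈ s
symEq-false {t} {s} e t≈s = case trans (sym e) (symEq-complete t s t≈s) of λ ()

symEq-respʳ : ∀ {s s′} → s ≈ s′ → ∀ t → symEq t s ≡ symEq t s′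
symEq-respʳ {s} {s′} s≈s′ t with symEq t s in e | symEq t s′ in e′
... | true  | true  = refl
... | false | false = refl
... | true  | false = contradiction (≈-trans (symEq-sound t s e) s≈s′) (symEq-false e′)
... | false | true  = contradiction (≈-trans (symEq-sound t s′ e′) (≈-sym s≈s′)) (symEq-false e)

coeff-resp : ∀ ξ {s s′} → s ≈ s′ → coeff ξ s ≡ coeff ξ s′
coeff-resp []            s≈s′ = refl
coeff-resp ((γ , t) ∷ ξ) {s′ = s′} s≈s′ rewrite symEq-respʳ s≈s′ t =
  cong (λ c → (if symEq t s′ then γ else 0ℤ) + c) (coeff-resp ξ s≈s′)

module _ {A : Set} (f : A → ℕ) where

  sum-map-zero : ∀ {xs} → All (λ x → f x ≡ 0) xs → sum (map f xs) ≡ 0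
  sum-map-zero []             = refl
  sum-map-zero (fx≡0 ∷ fxs≡0) rewrite fx≡0 = sum-map-zero fxs≡0

  sum-map-unique : DecidableEquality A → ∀ {w xs} → Unique xs → (∀ x → x ≢ w → f x ≡ 0) →
                   sum (map f xs) ℕ.≤ f w
  sum-map-unique _≟_     {xs = []}     []              off = z≤n
  sum-map-unique _≟_ {w} {xs = x ∷ xs} (x∉xs ∷ unique) off with x ≟ w
  ... | no x≢w rewrite off x x≢w = sum-map-unique _≟_ unique off
  ... | yes refl rewrite sum-map-zero (All.map (λ x≢y → off _ (x≢y ∘ sym)) x∉xs) =
    ℕ.≤-reflexive (ℕ.+-identityʳ (f x))

coeff-++ : ∀ ξ η s → coeff (ξ ++ η) s ≡ coeff ξ s + coeff η s
coeff-++ []            η s = sym (ℤ.+-identityˡ (coeff η s))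
coeff-++ ((γ , t) ∷ ξ) η s = begin
  γₛ + coeff (ξ ++ η) s        ≡⟨ cong (λ c → γₛ + c) (coeff-++ ξ η s) ⟩
  γₛ + (coeff ξ s + coeff η s) ≡⟨ ℤ.+-assoc γₛ _ _ ⟨
  γₛ + coeff ξ s + coeff η s   ∎
  where
  open ≡-Reasoning
  γₛ : ℤ
  γₛ = if symEq t s then γ else 0ℤ

negMul : ℤ → ℕ → ℤ
negMul γ k = - (γ * + k)

negMul-zero : ∀ γ → negMul γ 0 ≡ 0ℤ
negMul-zero γ = cong -_ (ℤ.*-zeroʳ γ)

negMul-+ : ∀ γ m n → negMul γ (m ℕ.+ n) ≡ negMul γ m + negMul γ n
negMul-+ γ m n = begin
  - (γ * + (m ℕ.+ n))     ≡⟨ cong (λ k → - (γ * k)) (ℤ.pos-+ m n) ⟩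
  - (γ * (+ m + + n))     ≡⟨ cong -_ (ℤ.*-distribˡ-+ γ (+ m) (+ n)) ⟩
  - (γ * + m + γ * + n)   ≡⟨ ℤ.neg-distrib-+ (γ * + m) (γ * + n) ⟩
  negMul γ m + negMul γ n ∎
  where open ≡-Reasoning

negMul-if : ∀ γ b k → (if b then negMul γ k else 0ℤ) ≡ negMul γ (if b then k else 0)
negMul-if γ true  k = refl
negMul-if γ false k = sym (negMul-zero γ)

module _ {A : Set} where

  coeff-map-negMul : ∀ γ (f : A → ℕ) (g : A → Symbol) xs s →
    coeff (map (λ x → negMul γ (f x) , g x) xs) s ≡
    negMul γ (sum (map (λ x → if symEq (g x) s then f x else 0) xs))
  coeff-map-negMul γ f g []       s = sym (negMul-zero γ)
  coeff-map-negMul γ f g (x ∷ xs) s = trans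
    (cong₂ _+_ (negMul-if γ (symEq (g x) s) (f x)) (coeff-map-negMul γ f g xs s))
    (sym (negMul-+ γ _ _))

  coeff-concatMap-negMul : ∀ γ (F : A → FElt) (k : A → ℕ) s →
    (∀ x → coeff (F x) s ≡ negMul γ (k x)) →
    ∀ xs → coeff (concatMap F xs) s ≡ negMul γ (sum (map k xs))
  coeff-concatMap-negMul γ F k s coeff-F []       = sym (negMul-zero γ)
  coeff-concatMap-negMul γ F k s coeff-F (x ∷ xs) = begin
    coeff (F x ++ concatMap F xs) s            ≡⟨ coeff-++ (F x) (concatMap F xs) s ⟩
    coeff (F x) s + coeff (concatMap F xs) s   ≡⟨ cong₂ _+_ (coeff-F x) rest ⟩
    negMul γ (k x) + negMul γ (sum (map k xs)) ≡⟨ negMul-+ γ (k x) _ ⟨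
    negMul γ (sum (map k (x ∷ xs)))            ∎
    where
    open ≡-Reasoning
    rest : coeff (concatMap F xs) s ≡ negMul γ (sum (map k xs))
    rest = coeff-concatMap-negMul γ F k s coeff-F xs

children : ℕ → ℕ → List (List ℕ)
children q x = map (x ∷_) (partsIn q x)

applyUpTo-suc-unique : (g : ℕ → List ℕ) → g 0 ≡ [] → (∀ m → g (suc m) ≡ g m ++ [ suc m ]) →
                       ∀ m → g m ≡ applyUpTo suc m
applyUpTo-suc-unique g g0 gsuc zero    = g0
applyUpTo-suc-unique g g0 gsuc (suc m) = trans (gsuc m)
  (trans (cong (_++ [ suc m ]) (applyUpTo-suc-unique g g0 gsuc m)) (applyUpTo-∷ʳ suc m))

-- `partsIn` enumerates the first parts with a `where`-local copy of `applyUpTo suc`, which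
-- cannot be named; abstracting `suc p` and `_++_` makes its occurrence a pattern, so the meta
-- `_` is solved by it.
partsIn-firstParts : (λ (firstParts : ℕ → ℕ → ℕ → List ℕ) → ∀ q p →
    (partsIn (suc q) (suc p) ≡ [] ∷ concatMap (children q) (firstParts q (suc p) p ++ [ suc p ]))
  × (∀ z m → firstParts q z m ≡ applyUpTo suc m)) _
partsIn-firstParts q p with suc p | _++_ {A = ℕ}
... | _ | _ = refl , λ z → applyUpTo-suc-unique _ refl (λ m → refl)

partsIn-suc : ∀ q p → partsIn (suc q) p ≡ [] ∷ concatMap (children q) (applyUpTo suc p)
partsIn-suc q zero    = refl
partsIn-suc q (suc p) with partsIn-firstParts q p
... | unfolds , firstParts≗range = trans unfolds (cong (λ xs → [] ∷ concatMap (children q) xs)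
  (trans (cong (_++ [ suc p ]) (firstParts≗range (suc p) p)) (applyUpTo-∷ʳ suc p)))

ZeroFree : List ℕ → Set
ZeroFree = All (0 ℕ.<_)

partsIn-zeroFree : ∀ q p → All ZeroFree (partsIn q p)
partsIn-zeroFree zero    p = [] ∷ []
partsIn-zeroFree (suc q) p rewrite partsIn-suc q p =
  [] ∷ All.concat⁺ (All.map⁺ (All.applyUpTo⁺₂ suc p children-zeroFree))
  where
  children-zeroFree : ∀ i → All ZeroFree (children q (suc i))
  children-zeroFree i = All.map⁺ (All.map (s≤s z≤n ∷_) (partsIn-zeroFree q (suc i)))

children-disjoint : ∀ q {x y} → x ≢ y → Disjoint (children q x) (children q y)
children-disjoint q {x} {y} x≢y (v∈x , v∈y) with ∈-map⁻ (x ∷_) v∈x | ∈-map⁻ (y ∷_) v∈y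
... | _ , _ , refl | _ , _ , v≡y∷w = x≢y (∷-injectiveˡ v≡y∷w)

partsIn-unique : ∀ q p → Unique (partsIn q p)
partsIn-unique zero    p = [] ∷ []
partsIn-unique (suc q) p rewrite partsIn-suc q p =
  []∉children ∷ Unique.concat⁺ (All.map⁺ (All.universal children-unique _))
                               (AllPairs.map⁺ (AllPairs.map (children-disjoint q) range-unique))
  where
  []∉children : All ([] ≢_) (concatMap (children q) (applyUpTo suc p))
  []∉children = All.concat⁺ (All.map⁺ {f = children q} (All.universal
    (λ x → All.map⁺ {f = x ∷_} (All.universal (λ _ ()) (partsIn q x))) (applyUpTo suc p)))
  children-unique : ∀ x → Unique (children q x)
  children-unique x = Unique.map⁺ ∷-injectiveʳ (partsIn-unique q x)
  range-unique : Unique (applyUpTo suc p)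
  range-unique = Unique.applyUpTo⁺₁ suc p (λ i<j _ → ℕ.<⇒≢ i<j ∘ ℕ.suc-injective)

subB-refl : ∀ x → subB x x ≡ true
subB-refl []      = refl
subB-refl (a ∷ x) rewrite ≤ᵇ-refl a = subB-refl x

lr-empty-diag-guard : ∀ x → (subB x x ∧ (sum x ≡ᵇ sum x ℕ.+ 0)) ≡ true
lr-empty-diag-guard x rewrite subB-refl x | ℕ.+-identityʳ (sum x) = ≡ᵇ-refl (sum x)

-- With the guard passed, each row of x / x is to be filled with c ∸ c = 0 boxes; once that is
-- rewritten, both sides reduce to the same count.
lr-empty-diag-step : ∀ c a x → lr (c ∷ a ∷ x) (c ∷ a ∷ x) [] ≡ lr (a ∷ x) (a ∷ x) []
lr-empty-diag-step c a x
  rewrite lr-empty-diag-guard (c ∷ a ∷ x) | lr-empty-diag-guard (a ∷ x) | ℕ.n∸n≡0 c | ℕ.n∸n≡0 a =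
  ℕ.+-identityʳ _

lr-empty-diag : ∀ x → lr x x [] ≡ 1
lr-empty-diag []          = refl
lr-empty-diag (c ∷ [])    rewrite lr-empty-diag-guard (c ∷ []) | ℕ.n∸n≡0 c = refl
lr-empty-diag (c ∷ a ∷ x) = trans (lr-empty-diag-step c a x) (lr-empty-diag (a ∷ x))

+-squeeze : ∀ {a b l r} → b ℕ.≤ a → r ℕ.≤ l → a ℕ.+ l ≡ b ℕ.+ r → a ≡ b × l ≡ r
+-squeeze {a} {b} {l} {r} b≤a r≤l eq =
  a≡b , ℕ.+-cancelˡ-≡ a l r (trans eq (cong (ℕ._+ r) (sym a≡b)))
  where
  a≤b : a ℕ.≤ b
  a≤b = ℕ.+-cancelʳ-≤ l a b (ℕ.≤-trans (ℕ.≤-reflexive eq) (ℕ.+-monoʳ-≤ b r≤l))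
  a≡b : a ≡ b
  a≡b = ℕ.≤-antisym a≤b b≤a

subB⇒sum≤ : ∀ ρ l → subB ρ l ≡ true → sum ρ ℕ.≤ sum l
subB⇒sum≤ []      l       _ = z≤n
subB⇒sum≤ (b ∷ ρ) (a ∷ l) e with ∧≡true (b ≤ᵇ a) (subB ρ l) e
... | b≤a , ρ⊆l = ℕ.+-mono-≤ (≤ᵇ-sound b a b≤a) (subB⇒sum≤ ρ l ρ⊆l)

subB∧sum≡⇒≡ : ∀ ρ l → ZeroFree l → subB ρ l ≡ true → sum l ≡ sum ρ → ρ ≡ l
subB∧sum≡⇒≡ []      []      _         _ _     = refl
subB∧sum≡⇒≡ []      (a ∷ l) (0<a ∷ _) _ |l|≡0 =
  contradiction (sym (ℕ.m+n≡0⇒m≡0 a |l|≡0)) (ℕ.<⇒≢ 0<a)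
subB∧sum≡⇒≡ (b ∷ ρ) (a ∷ l) (_ ∷ zf)  e |l|≡|ρ| with ∧≡true (b ≤ᵇ a) (subB ρ l) e
... | b≤a , ρ⊆l with +-squeeze (≤ᵇ-sound b a b≤a) (subB⇒sum≤ ρ l ρ⊆l) |l|≡|ρ|
...   | refl , |l|≡|ρ|′ = cong (b ∷_) (subB∧sum≡⇒≡ ρ l zf ρ⊆l |l|≡|ρ|′)

lr-empty-offDiag : ∀ l ρ → ZeroFree l → ρ ≢ l → lr l ρ [] ≡ 0
lr-empty-offDiag l ρ zf ρ≢l with subB ρ l in ρ⊆l | sum l ≡ᵇ sum ρ ℕ.+ 0 in |l|≡|ρ|
... | false | _     = refl
... | true  | false = refl
... | true  | true  = contradiction
  (subB∧sum≡⇒≡ ρ l zf ρ⊆l (trans (≡ᵇ-sound _ _ |l|≡|ρ|) (ℕ.+-identityʳ (sum ρ)))) ρ≢l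

coproductTerm : List ℕ → List (List ℕ) → Symbol → List ℕ → List ℕ → ℕ
coproductTerm lam L s ρ τ = if symEq (ρ , extend τ L) s then lr lam ρ τ else 0

coproductCoeff : List (List ℕ) → List ℕ → List (List ℕ) → Symbol → ℕ
coproductCoeff B lam L s = sum (map (λ ρ → sum (map (coproductTerm lam L s ρ) B)) B)

coeff-correction : ∀ n r γ lam L s →
  coeff (correction n r γ (lam , L)) s ≡ negMul γ (coproductCoeff (box n r) lam L s)
coeff-correction n r γ lam L s =
  coeff-concatMap-negMul γ _ _ s
    (λ ρ → coeff-map-negMul γ (lr lam ρ) (λ τ → ρ , extend τ L) (box n r) s) (box n r)

coproduct-diagonal : ∀ {lam L s ρ τ} → (lam , L) ≈ s → (ρ , extend τ L) ≈ s → ρ ≡ lam × τ ≡ []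
coproduct-diagonal {τ = []}    (lam≡ , _) (ρ≡ , _) = trans ρ≡ (sym lam≡) , refl
coproduct-diagonal {τ = _ ∷ _} (_ , L↭)   (_ , L′↭) =
  contradiction (trans (↭-length L′↭) (sym (↭-length L↭))) ℕ.1+n≢n

coproductTerm-offDiagonal : ∀ {lam L s} ρ τ → (lam , L) ≈ s → ¬ (ρ ≡ lam × τ ≡ []) →
                            coproductTerm lam L s ρ τ ≡ 0
coproductTerm-offDiagonal {L = L} {s} ρ τ self off with symEq (ρ , extend τ L) s in e
... | false = refl
... | true  = contradiction (coproduct-diagonal self (symEq-sound (ρ , extend τ L) s e)) off

coproductCoeff-self-≤1 : ∀ {B lam L s} → Unique B → (lam , L) ≈ s → coproductCoeff B lam L s ℕ.≤ 1
coproductCoeff-self-≤1 {B} {lam} {L} {s} unique self = begin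
  coproductCoeff B lam L s ≤⟨ sum-map-unique _ (≡-dec ℕ._≟_) unique offRow ⟩
  sum (map (term lam) B)   ≤⟨ sum-map-unique _ (≡-dec ℕ._≟_) unique offColumn ⟩
  term lam []              ≡⟨ cong (if_then lr lam lam [] else 0) (symEq-complete _ s self) ⟩
  lr lam lam []            ≡⟨ lr-empty-diag lam ⟩
  1                        ∎
  where
  open ℕ.≤-Reasoning
  term : List ℕ → List ℕ → ℕ
  term = coproductTerm lam L s
  offRow : ∀ ρ → ρ ≢ lam → sum (map (term ρ) B) ≡ 0
  offRow ρ ρ≢lam = sum-map-zero _
    (All.universal (λ τ → coproductTerm-offDiagonal ρ τ self (ρ≢lam ∘ proj₁)) B)
  offColumn : ∀ τ → τ ≢ [] → term lam τ ≡ 0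
  offColumn τ τ≢[] = coproductTerm-offDiagonal lam τ self (τ≢[] ∘ proj₂)

coproductCoeff-vanishes : ∀ {B lam L s} → ZeroFree lam → ¬ (lam , L) ≈ s →
                          length (proj₂ s) ≢ suc (length L) → coproductCoeff B lam L s ≡ 0
coproductCoeff-vanishes {B} {lam} {L} {s} zf ¬self |s|≢1+|L| =
  sum-map-zero _ (All.universal (λ ρ → sum-map-zero _ (All.universal (term-zero ρ) B)) B)
  where
  term-zero : ∀ ρ τ → coproductTerm lam L s ρ τ ≡ 0
  term-zero ρ [] with symEq (ρ , L) s in e
  ... | false = refl
  ... | true  = lr-empty-offDiag lam ρ zf (λ { refl → ¬self (symEq-sound (lam , L) s e) })
  term-zero ρ τ@(_ ∷ _) with symEq (ρ , τ ∷ L) s in e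
  ... | false = refl
  ... | true  =
    contradiction (sym (↭-length (proj₂ (symEq-sound (ρ , τ ∷ L) s e)))) |s|≢1+|L|

sign : Symbol → ℤ
sign s = negOnePow (suc (length (proj₂ s)))

sign-resp : ∀ {t s} → t ≈ s → sign t ≡ sign s
sign-resp (_ , L↭) = cong (λ k → negOnePow (suc k)) (↭-length L↭)

sign-next : ∀ {t s} → length (proj₂ s) ≡ suc (length (proj₂ t)) → sign s ≡ - sign t
sign-next = cong (λ k → negOnePow (suc k))

negOnePow≢0 : ∀ k → negOnePow k ≢ 0ℤ
negOnePow≢0 zero    ()
negOnePow≢0 (suc k) eq = negOnePow≢0 k (ℤ.neg-injective eq)

nonNeg-+ : ∀ {a b} → 0ℤ ≤ a → 0ℤ ≤ b → 0ℤ ≤ a + b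
nonNeg-+ = ℤ.+-mono-≤

nonNeg-*-pos : ∀ {a} k → 0ℤ ≤ a → 0ℤ ≤ a * + k
nonNeg-*-pos k = ℤ.*-monoʳ-≤-nonNeg (+ k)

nonNeg∧≢0⇒pos : ∀ k {c} → 0ℤ ≤ negOnePow k * c → c ≢ 0ℤ → 0ℤ < negOnePow k * c
nonNeg∧≢0⇒pos k εc≥0 c≢0 = ℤ.≤∧≢⇒< εc≥0
  (λ 0≡εc → [ negOnePow≢0 k , c≢0 ]′ (ℤ.i*j≡0⇒i≡0∨j≡0 _ (sym 0≡εc)))

signCorrect-chosen : ∀ ε ε′ c γ k → ε′ ≡ ε → c ≡ γ → k ℕ.≤ 1 → 0ℤ ≤ ε * γ →
                     0ℤ ≤ ε′ * (c + negMul γ k)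
signCorrect-chosen ε _ _ γ zero       refl refl _ εγ≥0
  rewrite negMul-zero γ | ℤ.+-identityʳ γ = εγ≥0
signCorrect-chosen ε _ _ γ (suc zero) refl refl _ _
  rewrite ℤ.*-identityʳ γ | ℤ.+-inverseʳ γ | ℤ.*-zeroʳ ε = +≤+ z≤n
signCorrect-chosen _ _ _ _ (suc (suc k)) _ _ (s≤s ()) _

signCorrect-longer : ∀ ε ε′ c γ k → ε′ ≡ - ε → 0ℤ ≤ ε′ * c → 0ℤ ≤ ε * γ →
                     0ℤ ≤ ε′ * (c + negMul γ k)
signCorrect-longer ε _ c γ k refl εc≥0 εγ≥0 =
  subst (0ℤ ≤_) (sym expand) (nonNeg-+ εc≥0 (nonNeg-*-pos k εγ≥0))
  where
  open +-*-Solver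
  expand : (- ε) * (c + negMul γ k) ≡ (- ε) * c + ε * γ * + k
  expand = solve 4 (λ ε c γ k → (:- ε) :* (c :+ :- (γ :* k)) := (:- ε) :* c :+ ε :* γ :* k)
                   refl ε c γ (+ k)

signCorrect-untouched : ∀ ε c γ k → k ≡ 0 → 0ℤ ≤ ε * c → 0ℤ ≤ ε * (c + negMul γ k)
signCorrect-untouched ε c γ _ refl εc≥0 rewrite negMul-zero γ | ℤ.+-identityʳ c = εc≥0

SignCorrect : FElt → Set
SignCorrect ξ = ∀ s → 0ℤ ≤ sign s * coeff ξ s

signCorrect-entrywise : ∀ {ξ} → All (λ e → 0ℤ ≤ sign (proj₂ e) * proj₁ e) ξ → SignCorrect ξ
signCorrect-entrywise [] s rewrite ℤ.*-zeroʳ (sign s) = +≤+ z≤n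
signCorrect-entrywise {(γ , t) ∷ ξ} (εγ≥0 ∷ εξ≥0) s
  rewrite ℤ.*-distribˡ-+ (sign s) (if symEq t s then γ else 0ℤ) (coeff ξ s) =
  nonNeg-+ entry (signCorrect-entrywise εξ≥0 s)
  where
  entry : 0ℤ ≤ sign s * (if symEq t s then γ else 0ℤ)
  entry with symEq t s in e
  ... | true  = subst (λ ε → 0ℤ ≤ ε * γ) (sign-resp (symEq-sound t s e)) εγ≥0
  ... | false rewrite ℤ.*-zeroʳ (sign s) = +≤+ z≤n

signCorrect-step : ∀ n r ξ lam L → SignCorrect ξ → ZeroFree lam →
                   SignCorrect (ξ ++ correction n r (coeff ξ (lam , L)) (lam , L))
signCorrect-step n r ξ lam L ok zf s = subst (λ c → 0ℤ ≤ sign s * c) (sym new-coeff) by-cases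
  where
  γ : ℤ
  γ = coeff ξ (lam , L)
  K : ℕ
  K = coproductCoeff (box n r) lam L s
  new-coeff : coeff (ξ ++ correction n r γ (lam , L)) s ≡ coeff ξ s + negMul γ K
  new-coeff = trans (coeff-++ ξ _ s) (cong (λ c → coeff ξ s + c) (coeff-correction n r γ lam L s))
  by-cases : 0ℤ ≤ sign s * (coeff ξ s + negMul γ K)
  by-cases with symEq (lam , L) s in e
  ... | true  = signCorrect-chosen (sign (lam , L)) (sign s) (coeff ξ s) γ K
                  (sym (sign-resp self)) (coeff-resp ξ (≈-sym self))
                  (coproductCoeff-self-≤1 (partsIn-unique r (n ∸ r)) self) (ok (lam , L))
    where
    self : (lam , L) ≈ s
    self = symEq-sound (lam , L) s e
  ... | false with length (proj₂ s) ℕ.≟ suc (length L)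
  ...   | yes |s|≡1+|L| = signCorrect-longer (sign (lam , L)) (sign s) (coeff ξ s) γ K
                            (sign-next {lam , L} {s} |s|≡1+|L|) (ok s) (ok (lam , L))
  ...   | no  |s|≢1+|L| = signCorrect-untouched (sign s) (coeff ξ s) γ K
                            (coproductCoeff-vanishes {box n r} {lam} {L} {s} zf (symEq-false e) |s|≢1+|L|)
                            (ok s)

All-if : ∀ {A : Set} {P : A → Set} {b xs} → All P xs → All P (if b then xs else [])
All-if {b = true}  all = all
All-if {b = false} _   = []

All-support : ∀ {P : List ℕ → Set} ξ {s} → All (P ∘ proj₁ ∘ proj₂) ξ → coeff ξ s ≢ 0ℤ → P (proj₁ s)
All-support []            []         c≢0 = contradiction refl c≢0
All-support {P} ((γ , t) ∷ ξ) {s} (pt ∷ pξ) c≢0 with symEq t s in e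
... | true  = subst P (proj₁ (symEq-sound t s e)) pt
... | false = All-support ξ pξ (c≢0 ∘ trans (ℤ.+-identityˡ (coeff ξ s)))

correction-zeroFree : ∀ n r γ lam L → All (ZeroFree ∘ proj₁ ∘ proj₂) (correction n r γ (lam , L))
correction-zeroFree n r γ lam L = All.concat⁺
  (All.gmap⁺ (λ zf → All.map⁺ (All.universal (λ _ → zf) (box n r))) (partsIn-zeroFree r (n ∸ r)))

-- `lr` compares shapes as lists, so c^λ_{ρ,∅} = [ρ = λ] needs λ without zero parts; every
-- λ in ξ comes from the box enumeration, which has none.
record Invariant (ξ : FElt) : Set where
  field
    signCorrect : SignCorrect ξ
    zeroFree    : All (ZeroFree ∘ proj₁ ∘ proj₂) ξ

xi0-invariant : ∀ n r j N ν → Invariant (xi0 n r j N ν)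
xi0-invariant n r j N ν = record
  { signCorrect = signCorrect-entrywise (All.map proj₁ entries)
  ; zeroFree    = All.map proj₂ entries
  }
  where
  box-zeroFree : All ZeroFree (box n r)
  box-zeroFree = partsIn-zeroFree r (n ∸ r)
  0≤1*+ : ∀ {m} → 0ℤ ≤ 1ℤ * + m
  0≤1*+ {m} = subst (0ℤ ≤_) (sym (ℤ.*-identityˡ (+ m))) (+≤+ z≤n)
  entries : All (λ e → 0ℤ ≤ sign (proj₂ e) * proj₁ e × ZeroFree (proj₁ (proj₂ e))) (xi0 n r j N ν)
  entries = All.concat⁺ (All.gmap⁺
    (λ zf → All-if (All.concat⁺ (All.gmap⁺ (λ _ → All-if ((0≤1*+ , zf) ∷ [])) box-zeroFree)))
    box-zeroFree)

step-preserves : ∀ {n r ξ ξ′} → Step n r ξ ξ′ → Invariant ξ → Invariant ξ′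
step-preserves {n} {r} (step ξ lam L _ γ≢0) inv = record
  { signCorrect = signCorrect-step n r ξ lam L signCorrect (All-support ξ zeroFree γ≢0)
  ; zeroFree    = All.++⁺ zeroFree (correction-zeroFree n r (coeff ξ (lam , L)) lam L)
  }
  where open Invariant inv

reachable-invariant : ∀ {n r ξ ξ′} → Star (Step n r) ξ ξ′ → Invariant ξ → Invariant ξ′
reachable-invariant =
  fold (λ ξ ξ′ → Invariant ξ → Invariant ξ′) (λ st rest → rest ∘ step-preserves st) id

proposition3p8 : (n r i j a b N : ℕ) → Valid n r i j a b N →
    (ν : List ℕ) → InD n r i j a b N ν → Tall i ν →
    (ξ : FElt) → Reachable n r j N ν ξ →
    (lam : List ℕ) (L : List (List ℕ)) →
    (coeff ξ (lam , L) ≡ 0ℤ → ⊥) →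
    0ℤ < negOnePow (suc (length L)) * coeff ξ (lam , L)
proposition3p8 n r i j a b N _ ν _ _ ξ reachable lam L γ≢0 =
  nonNeg∧≢0⇒pos (suc (length L))
    (Invariant.signCorrect (reachable-invariant reachable (xi0-invariant n r j N ν)) (lam , L)) γ≢0
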